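{- Let $\gamma$ be a path through the rank diagram, and let $(\dots, A, B \cdot C, \dots)$ be a factor sequence for $\gamma$ such that $A$ and $B\cdot C$ are the labels of two consecutive line segments of $\gamma$ and the product $B \cdot C$ is the label of a down-going line segment. Then $(\dots, A \cdot B, C, \dots)$ (with all other labels unchanged) is also a factor sequence for $\gamma$.
   Context: Setting. Fix non-negative integers $r = (r_{ij})_{0\le i\le j\le n}$ (rank conditions, assumed to be able to occur, i.e. $r_{ij} \le \min(r_{i,j-1}, r_{i+1,j})$ and $r_{ij} - r_{i,j-1} - r_{i+1,j} + r_{i+1,j-1} \ge 0$). They are arranged in a triangular rank diagram: the top row is $r_{00}, r_{11}, \dots, r_{nn}$, the next row $r_{01}, r_{12}, \dots, r_{n-1,n}$, and so on down to $r_{0n}$, with $r_{ij}$ placed below and between $r_{i,j-1}$ and $r_{i+1,j}$. To each small triangle $r_{i,j-1}, r_{i+1,j}$ (top), $r_{ij}$ (bottom) one associates a rectangle $R_{ij}$ with $r_{i+1,j} - r_{ij}$ rows and $r_{i,j-1} - r_{ij}$ columns. A tableau diagram is a filling of every $R_{ij}$ with integers making it a (semistandard) tableau $T_{ij}$, such that the entries of $T_{ij}$ are strictly larger than all entries of the tableaux $T_{kl}$ with $i \le k < l \le j$, $(k,l)\neq(i,j)$. Fix such a tableau diagram. Tableaux are multiplied with the usual (plactic/row-bumping) product. A path through the rank diagram is a union of line segments between neighboring entries forming a continuous path from $r_{00}$ to $r_{nn}$ which meets every vertical line at most once (segments are horizontal, e.g. $r_{ij}$ to $r_{i+1,j+1}$,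 or diagonal, going down $r_{ij}$ to $r_{i,j+1}$ or up $r_{ij}$ to $r_{i+1,j}$). A factor sequence for a path is a labeling of its line segments, left to right, by tableaux, defined inductively: for the lowest path $r_{00}\to r_{0n}\to r_{nn}$ the only factor sequence assigns the empty tableau to every segment. Otherwise there is a lower path $\gamma'$ differing from $\gamma$ at one place in one of two ways. Case 1: where $\gamma$ goes up then down ($r_{ij}\to r_{i+1,j}\to r_{i+1,j+1}$), $\gamma'$ takes the horizontal segment $r_{ij}\to r_{i+1,j+1}$; if $(\dots, W, \dots)$ is a factor sequence for $\gamma'$ with $W$ on that segment and $W = P\cdot Q$ is any factorization, then $(\dots, P, Q, \dots)$ is a factor sequence for $\gamma$. Case 2: where $\gamma$ takes a horizontal segment $r_{i,j-1}\to r_{i+1,j}$, $\gamma'$ goes down then up ($r_{i,j-1}\to r_{ij}\to r_{i+1,j}$); with $T = T_{ij}$ the tableau of this triangle, if $(\dots, Q, P, \dots)$ is a factor sequence for $\gamma'$ with $Q,P$ on these two segments, then $(\dots, Q\cdot T\cdot P, \dots)$ is a factor sequence for $\gamma$. -}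

module Defs where

open import Data.Nat using (ℕ; zero; suc; _≤_; _<_; _∸_; _+_)
open import Data.Integer using (ℤ) renaming (_<_ to _<ℤ_; _≤_ to _≤ℤ_)
open import Data.Integer.Properties using () renaming (_<?_ to _<ℤ?_)
open import Data.List using (List; []; _∷_; _++_; concat; reverse; foldl; replicate; length)
open import Data.List.Relation.Unary.All using (All)
open import Data.List.Relation.Unary.Linked using (Linked)
open import Data.Maybe using (Maybe; just; nothing)
open import Data.Product using (_×_; _,_; Σ)
open import Data.Unit using (⊤)
open import Data.Empty using (⊥)
open import Relation.Nullary using (¬_; yes; no)
open import Relation.Binary.PropositionalEquality using (_≡_; _≢_)

-- Tableaux: a tableau is the list of its rows (top to bottom), entries in ℤ.

Tableau : Set
Tableau = List (List ℤ)

-- column strictness between a row and the row directly below it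
-- (also forces the lower row to be no longer than the upper one)
ColStrict : List ℤ → List ℤ → Set
ColStrict _        []       = ⊤
ColStrict []       (_ ∷ _)  = ⊥
ColStrict (x ∷ xs) (y ∷ ys) = (x <ℤ y) × ColStrict xs ys

IsTableau : Tableau → Set
IsTableau t = All (λ row → row ≢ []) t
            × All (Linked _≤ℤ_) t
            × Linked ColStrict t

entries : Tableau → List ℤ
entries = concat

rowIns : ℤ → List ℤ → Maybe ℤ × List ℤ
rowIns x [] = nothing , x ∷ []
rowIns x (y ∷ ys) with x <ℤ? y
... | yes _ = just y , x ∷ ys
... | no _  with rowIns x ys
...   | b , ys' = b , y ∷ ys'

insert : ℤ → Tableau → Tableau
insert x [] = (x ∷ []) ∷ []
insert x (row ∷ rows) with rowIns x row
... | nothing , row' = row' ∷ rows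
... | just y  , row' = row' ∷ insert y rows

readingWord : Tableau → List ℤ
readingWord t = concat (reverse t)

infixl 7 _·_
_·_ : Tableau → Tableau → Tableau
P · Q = foldl (λ t x → insert x t) P (readingWord Q)

rectShape : ℕ → ℕ → List ℕ
rectShape a zero    = []
rectShape a (suc b) = replicate a (suc b)

-- Rank conditions r_{ij}, 0 ≤ i ≤ j ≤ n, given as a function ℕ → ℕ → ℕ
-- (values outside the range are irrelevant).

RankConditions : ℕ → (ℕ → ℕ → ℕ) → Set
RankConditions n r =
    (∀ i j → i < j → j ≤ n → r i j ≤ r i (j ∸ 1))
  × (∀ i j → i < j → j ≤ n → r i j ≤ r (suc i) j)
  × (∀ i j → suc i < j → j ≤ n →
       r i (j ∸ 1) + r (suc i) j ≤ r i j + r (suc i) (j ∸ 1))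

-- Tableau diagram: T i j is the filling of R_ij (0 ≤ i < j ≤ n), which has
-- r_{i+1,j} - r_{ij} rows and r_{i,j-1} - r_{ij} columns.
TableauDiagram : ℕ → (ℕ → ℕ → ℕ) → (ℕ → ℕ → Tableau) → Set
TableauDiagram n r T =
  ∀ i j → i < j → j ≤ n →
      IsTableau (T i j)
    × Data.List.map length (T i j) ≡ rectShape (r (suc i) j ∸ r i j) (r i (j ∸ 1) ∸ r i j)
    × (∀ k l → i ≤ k → k < l → l ≤ j → ¬ (k ≡ i × l ≡ j) →
         All (λ x → All (λ y → y <ℤ x) (entries (T k l))) (entries (T i j)))

-- Paths through the rank diagram, as step sequences starting at r_00.
-- H : r_ij → r_{i+1,j+1} (horizontal), D : r_ij → r_{i,j+1} (down),
-- U : r_ij → r_{i+1,j} (up).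

data Step : Set where
  H D U : Step

PathFrom : ℕ → ℕ → ℕ → List Step → Set
PathFrom n i j []       = (i ≡ n) × (j ≡ n)
PathFrom n i j (H ∷ s)  = PathFrom n (suc i) (suc j) s
PathFrom n i j (D ∷ s)  = PathFrom n i (suc j) s
PathFrom n i j (U ∷ s)  = (suc i ≤ j) × PathFrom n (suc i) j s

IsPath : ℕ → List Step → Set
IsPath n γ = PathFrom n 0 0 γ

walk : ℕ × ℕ → List Step → ℕ × ℕ
walk p [] = p
walk (i , j) (H ∷ s) = walk (suc i , suc j) s
walk (i , j) (D ∷ s) = walk (i , suc j) s
walk (i , j) (U ∷ s) = walk (suc i , j) s

lowest : ℕ → List Step
lowest n = replicate n D ++ replicate n U

fst : ℕ × ℕ → ℕ
fst (a , _) = a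

snd : ℕ × ℕ → ℕ
snd (_ , b) = b

-- Factor sequences (labels of the segments, left to right), inductively.
data FactorSeq (n : ℕ) (T : ℕ → ℕ → Tableau) : List Step → List Tableau → Set where
  lowestFS : FactorSeq n T (lowest n) (replicate (n + n) [])
  case1 : ∀ pre post ls rs W P Q →
          IsPath n (pre ++ U ∷ D ∷ post) →
          length ls ≡ length pre →
          FactorSeq n T (pre ++ H ∷ post) (ls ++ W ∷ rs) →
          IsTableau P → IsTableau Q → W ≡ P · Q →
          FactorSeq n T (pre ++ U ∷ D ∷ post) (ls ++ P ∷ Q ∷ rs)
  -- Case 2: γ' has D U (through r_ij) where γ has H (r_{i,j-1} → r_{i+1,j})
  case2 : ∀ pre post ls rs Q P →
          IsPath n (pre ++ H ∷ post) →
          length ls ≡ length pre →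
          FactorSeq n T (pre ++ D ∷ U ∷ post) (ls ++ Q ∷ P ∷ rs) →
          FactorSeq n T (pre ++ H ∷ post)
            (ls ++ (Q · T (fst (walk (0 , 0) pre)) (suc (snd (walk (0 , 0) pre))) · P) ∷ rs)

-- Induct on the factor sequence. If the pair of segments carrying (A, B · C) is disjoint from
-- the place where the last rule acted, rebracket in the earlier factor sequence and apply the
-- rule again. If it overlaps that place, the claim is an instance of associativity of the
-- plactic product, e.g. W = P · (B · C) = (P · B) · C for case 1. The pair cannot end exactly
-- where the rule acted, because there the step is U or H, not D. On the lowest path all labels
-- are empty, which forces B = C = [].
--
-- Associativity is the classical consequence of Knuth's theorem: the reading word of P · Q is
-- Knuth-equivalent to the reading word of P followed by that of Q, and inserting a word into a
-- tableau with weakly increasing rows depends only on the Knuth class of the word. The latter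
-- is checked one row and one elementary Knuth move at a time.

module Submission where

open import Defs
open import Data.Integer using (ℤ) renaming (_<_ to _<ℤ_; _≤_ to _≤ℤ_)
open import Data.Integer.Properties
  using (≤-refl; ≤-trans; <-trans; <⇒≤; ≤-<-trans; <-≤-trans; ≮⇒≥; ≤⇒≯)
  renaming (_<?_ to _<ℤ?_)
open import Data.List
  using (List; []; _∷_; _++_; foldl; fromMaybe; head; length; concat; reverse; replicate)
open import Data.List.Properties
  using (∷-injective; ++-assoc; ++-identityʳ; ++-conicalʳ; length-++; foldl-++; concat-++; unfold-reverse)
open import Data.List.Relation.Unary.All using (All; []; _∷_)
import Data.List.Relation.Unary.All as All
import Data.List.Relation.Unary.All.Properties as All
open import Data.List.Relation.Unary.AllPairs using (_∷_)
open import Data.List.Relation.Unary.Linked as Linked using (Linked; []; [-]; _∷_; _∷′_)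
open import Data.List.Relation.Unary.Linked.Properties using (Linked⇒AllPairs)
open import Data.Maybe using (Maybe; just; nothing)
open import Data.Maybe.Relation.Binary.Connected using (Connected; just; just-nothing)
open import Data.Maybe.Relation.Unary.All as Maybe using (just; nothing)
open import Data.Nat using (ℕ; suc; _+_; _≤_; z≤n; s≤s)
import Data.Nat.Properties as ℕ
open import Data.Product using (_×_; _,_; proj₁; proj₂; map₁; map₂; ∃-syntax)
open import Data.Sum using (_⊎_; inj₁; inj₂)
open import Data.Unit using (tt)
open import Function using (_∘_)
open import Relation.Binary.Bundles using (Setoid)
open import Relation.Binary.Construct.Closure.Equivalence as EqClosure using (EqClosure)
open import Relation.Binary.PropositionalEquality
import Relation.Binary.Reasoning.Setoid as SetoidReasoning
open import Relation.Binary.Structures using (IsEquivalence)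
open import Relation.Nullary using (yes; no; contradiction)

-- Row insertion

Sorted : List ℤ → Set
Sorted = Linked _≤ℤ_

RowsSorted : Tableau → Set
RowsSorted = All Sorted

_<or≥_ : ∀ x y → x <ℤ y ⊎ y ≤ℤ x
x <or≥ y with x <ℤ? y
... | yes x<y = inj₁ x<y
... | no x≮y = inj₂ (≮⇒≥ x≮y)

bumped : ℤ → List ℤ → Maybe ℤ
bumped x R = proj₁ (rowIns x R)

inserted : ℤ → List ℤ → List ℤ
inserted x R = proj₂ (rowIns x R)

rowIns-< : ∀ {x r R} → x <ℤ r → rowIns x (r ∷ R) ≡ (just r , x ∷ R)
rowIns-< {x} {r} x<r with x <ℤ? r
... | yes _ = refl
... | no x≮r = contradiction x<r x≮r

rowIns-≥ : ∀ {x r R b R′} → r ≤ℤ x → rowIns x R ≡ (b , R′) → rowIns x (r ∷ R) ≡ (b , r ∷ R′)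
rowIns-≥ {x} {r} r≤x refl with x <ℤ? r
... | yes x<r = contradiction x<r (≤⇒≯ r≤x)
... | no _ = refl

inserted-nonempty : ∀ x R → inserted x R ≢ []
inserted-nonempty x [] ()
inserted-nonempty x (r ∷ R) with x <ℤ? r
... | yes _ = λ ()
... | no _ = λ ()

bumped-> : ∀ x R → Maybe.All (x <ℤ_) (bumped x R)
bumped-> x [] = nothing
bumped-> x (r ∷ R) with x <ℤ? r
... | yes x<r = just x<r
... | no _ = bumped-> x R

bumped-All : ∀ {P : ℤ → Set} {x R} → All P R → Maybe.All P (bumped x R)
bumped-All [] = nothing
bumped-All {x = x} {r ∷ R} (pr ∷ pR) with x <ℤ? r
... | yes _ = just pr
... | no _ = bumped-All pR

atJust : ∀ {P : ℤ → Set} {m c} → Maybe.All P m → m ≡ just c → P c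
atJust (just p) refl = p

_≤Head_ : ℤ → List ℤ → Set
r ≤Head R = Connected _≤ℤ_ (just r) (head R)

≤Head-inserted : ∀ {r x} R → r ≤ℤ x → r ≤Head R → r ≤Head inserted x R
≤Head-inserted [] r≤x _ = just r≤x
≤Head-inserted {x = x} (h ∷ R) r≤x r≤h with x <ℤ? h
... | yes _ = just r≤x
... | no _ = r≤h

≤Head-trans : ∀ {x r} R → x ≤ℤ r → r ≤Head R → x ≤Head R
≤Head-trans [] _ _ = just-nothing
≤Head-trans (h ∷ R) x≤r (just r≤h) = just (≤-trans x≤r r≤h)

inserted-above-bumped : ∀ x R → Maybe.All (λ c → ColStrict (inserted x R) (c ∷ [])) (bumped x R)
inserted-above-bumped x [] = nothing
inserted-above-bumped x (r ∷ R) with x <ℤ? r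
... | yes x<r = just (x<r , tt)
... | no x≮r = Maybe.map (λ x<c → ≤-<-trans (≮⇒≥ x≮r) x<c , tt) (bumped-> x R)

inserted-sorted : ∀ x R → Sorted R → Sorted (inserted x R)
inserted-sorted x [] _ = [-]
inserted-sorted x (r ∷ R) s with x <ℤ? r
... | yes x<r = ≤Head-trans R (<⇒≤ x<r) (Linked.head′ s) ∷′ Linked.tail s
... | no x≮r = ≤Head-inserted R (≮⇒≥ x≮r) (Linked.head′ s) ∷′ inserted-sorted x R (Linked.tail s)

rowInsWord : List ℤ → List ℤ → List ℤ × List ℤ
rowInsWord R [] = [] , R
rowInsWord R (a ∷ w) = map₁ (fromMaybe (bumped a R) ++_) (rowInsWord (inserted a R) w)

bumpedWord : List ℤ → List ℤ → List ℤ
bumpedWord R w = proj₁ (rowInsWord R w)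

insertedWord : List ℤ → List ℤ → List ℤ
insertedWord R w = proj₂ (rowInsWord R w)

rowInsWord-∷ : ∀ {a R b R′} w → rowIns a R ≡ (b , R′) →
               rowInsWord R (a ∷ w) ≡ map₁ (fromMaybe b ++_) (rowInsWord R′ w)
rowInsWord-∷ w eq = cong (λ p → map₁ (fromMaybe (proj₁ p) ++_) (rowInsWord (proj₂ p) w)) eq

rowInsWord-++ : ∀ R u v → rowInsWord R (u ++ v) ≡
  (bumpedWord R u ++ bumpedWord (insertedWord R u) v , insertedWord (insertedWord R u) v)
rowInsWord-++ R [] v = refl
rowInsWord-++ R (a ∷ u) v rewrite rowInsWord-++ (inserted a R) u v =
  cong (_, insertedWord (insertedWord (inserted a R) u) v) (sym (++-assoc (fromMaybe (bumped a R)) _ _))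

insertedWord-sorted : ∀ R w → Sorted R → Sorted (insertedWord R w)
insertedWord-sorted R [] s = s
insertedWord-sorted R (a ∷ w) s = insertedWord-sorted _ w (inserted-sorted a R s)

insertWord : Tableau → List ℤ → Tableau
insertWord = foldl (λ t x → insert x t)

insert-∷ : ∀ x R P → insert x (R ∷ P) ≡ inserted x R ∷ insertWord P (fromMaybe (bumped x R))
insert-∷ x R P with rowIns x R
... | nothing , _ = refl
... | just _ , _ = refl

insertWord-∷ : ∀ R P w → insertWord (R ∷ P) w ≡ insertedWord R w ∷ insertWord P (bumpedWord R w)
insertWord-∷ R P [] = refl
insertWord-∷ R P (x ∷ w) = begin
  insertWord (insert x (R ∷ P)) w
    ≡⟨ cong (λ t → insertWord t w) (insert-∷ x R P) ⟩
  insertWord (inserted x R ∷ insertWord P b) w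
    ≡⟨ insertWord-∷ _ _ w ⟩
  _ ∷ insertWord (insertWord P b) (bumpedWord (inserted x R) w)
    ≡⟨ cong (_ ∷_) (sym (foldl-++ _ P b _)) ⟩
  _ ∷ insertWord P (b ++ bumpedWord (inserted x R) w) ∎
  where
  open ≡-Reasoning
  b = fromMaybe (bumped x R)

insert-rowsSorted : ∀ x P → RowsSorted P → RowsSorted (insert x P)
insert-rowsSorted x [] _ = [-] ∷ []
insert-rowsSorted x (R ∷ P) (s ∷ ss) rewrite insert-∷ x R P with bumped x R
... | nothing = inserted-sorted x R s ∷ ss
... | just c = inserted-sorted x R s ∷ insert-rowsSorted c P ss

insertWord-preserves : ∀ (Inv : Tableau → Set) → (∀ x P → Inv P → Inv (insert x P)) →
                       ∀ P w → Inv P → Inv (insertWord P w)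
insertWord-preserves Inv step P [] i = i
insertWord-preserves Inv step P (x ∷ w) i = insertWord-preserves Inv step (insert x P) w (step x P i)

·-rowsSorted : ∀ P Q → RowsSorted P → RowsSorted (P · Q)
·-rowsSorted P Q = insertWord-preserves RowsSorted insert-rowsSorted P (readingWord Q)

insert-nonempty : ∀ x P → All (_≢ []) P → All (_≢ []) (insert x P)
insert-nonempty x [] _ = (λ ()) ∷ []
insert-nonempty x (R ∷ P) (ne ∷ nes) rewrite insert-∷ x R P with bumped x R
... | nothing = inserted-nonempty x R ∷ nes
... | just c = inserted-nonempty x R ∷ insert-nonempty c P nes

inserted-colStrict : ∀ {x} R R₂ → ColStrict R R₂ → ColStrict (inserted x R) R₂
inserted-colStrict _ [] _ = tt
inserted-colStrict {x} (r ∷ R) (s ∷ R₂) (r<s , cs) with x <ℤ? r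
... | yes x<r = <-trans x<r r<s , cs
... | no _ = r<s , inserted-colStrict R R₂ cs

bumped-colStrict : ∀ x R R₂ → ColStrict R R₂ →
                   Maybe.All (λ c → ColStrict (inserted x R) (inserted c R₂)) (bumped x R)
bumped-colStrict x [] _ _ = nothing
bumped-colStrict x (r ∷ R) [] _ = inserted-above-bumped x (r ∷ R)
bumped-colStrict x (r ∷ R) (s ∷ R₂) (r<s , cs) with x <ℤ? r
... | yes x<r = just (subst (ColStrict (x ∷ R) ∘ proj₂) (sym (rowIns-< r<s)) (x<r , cs))
... | no x≮r = Maybe.zipWith below (bumped-> x R , bumped-colStrict x R R₂ cs)
  where
  below : ∀ {c} → x <ℤ c × ColStrict (inserted x R) (inserted c R₂) →
          ColStrict (r ∷ inserted x R) (inserted c (s ∷ R₂))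
  below {c} (x<c , rec) with c <or≥ s
  ... | inj₁ c<s = subst (ColStrict _ ∘ proj₂) (sym (rowIns-< c<s))
                     (≤-<-trans (≮⇒≥ x≮r) x<c , inserted-colStrict R R₂ cs)
  ... | inj₂ s≤c = subst (ColStrict _ ∘ proj₂) (sym (rowIns-≥ s≤c refl)) (r<s , rec)

insert-colStrict : ∀ x P → Linked ColStrict P → Linked ColStrict (insert x P)
insert-colStrict x [] _ = [-]
insert-colStrict x (R ∷ []) _ rewrite insert-∷ x R [] with bumped x R | inserted-above-bumped x R
... | nothing | _ = [-]
... | just c | just below = below ∷ [-]
insert-colStrict x (R ∷ R₂ ∷ P) (cs ∷ l) rewrite insert-∷ x R (R₂ ∷ P)
  with bumped x R | bumped-colStrict x R R₂ cs
... | nothing | _ = inserted-colStrict R R₂ cs ∷ l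
... | just c | just below rewrite insert-∷ c R₂ P =
  below ∷ subst (Linked ColStrict) (insert-∷ c R₂ P) (insert-colStrict c (R₂ ∷ P) l)

insert-isTableau : ∀ x P → IsTableau P → IsTableau (insert x P)
insert-isTableau x P (ne , s , cs) = insert-nonempty x P ne , insert-rowsSorted x P s , insert-colStrict x P cs

·-isTableau : ∀ P Q → IsTableau P → IsTableau (P · Q)
·-isTableau P Q = insertWord-preserves IsTableau insert-isTableau P (readingWord Q)

-- Knuth equivalence and reading words

data KnuthMove : List ℤ → List ℤ → Set where
  yxz↝yzx : ∀ {x y z} → x <ℤ y → y ≤ℤ z → KnuthMove (y ∷ x ∷ z ∷ []) (y ∷ z ∷ x ∷ [])
  xzy↝zxy : ∀ {x y z} → x ≤ℤ y → y <ℤ z → KnuthMove (x ∷ z ∷ y ∷ []) (z ∷ x ∷ y ∷ [])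

data KnuthStep : List ℤ → List ℤ → Set where
  inContext : ∀ p q {u v} → KnuthMove u v → KnuthStep (p ++ u ++ q) (p ++ v ++ q)

infix 4 _≈ₖ_
_≈ₖ_ : List ℤ → List ℤ → Set
_≈ₖ_ = EqClosure KnuthStep

open Setoid (EqClosure.setoid KnuthStep) using ()
  renaming (refl to ≈ₖ-refl; sym to ≈ₖ-sym; trans to ≈ₖ-trans; reflexive to ≈ₖ-reflexive)

module ≈ₖ-Reasoning = SetoidReasoning (EqClosure.setoid KnuthStep)

knuthAt : ∀ p q {u v} → KnuthMove u v → p ++ u ++ q ≈ₖ p ++ v ++ q
knuthAt p q m = EqClosure.return (inContext p q m)

knuth : ∀ {u v} → KnuthMove u v → u ≈ₖ v
knuth {u} {v} m = subst₂ _≈ₖ_ (++-identityʳ u) (++-identityʳ v) (knuthAt [] [] m)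

≈ₖ-congˡ : ∀ p {u v} → u ≈ₖ v → p ++ u ≈ₖ p ++ v
≈ₖ-congˡ p = EqClosure.gmap (p ++_) step
  where
  step : ∀ {u v} → KnuthStep u v → KnuthStep (p ++ u) (p ++ v)
  step (inContext p′ q′ {u} {v} m) =
    subst₂ KnuthStep (++-assoc p p′ (u ++ q′)) (++-assoc p p′ (v ++ q′)) (inContext (p ++ p′) q′ m)

≈ₖ-congʳ : ∀ q {u v} → u ≈ₖ v → u ++ q ≈ₖ v ++ q
≈ₖ-congʳ q = EqClosure.gmap (_++ q) step
  where
  reassoc : ∀ p′ w q′ → p′ ++ w ++ q′ ++ q ≡ (p′ ++ w ++ q′) ++ q
  reassoc p′ w q′ = sym (trans (++-assoc p′ (w ++ q′) q) (cong (p′ ++_) (++-assoc w q′ q)))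
  step : ∀ {u v} → KnuthStep u v → KnuthStep (u ++ q) (v ++ q)
  step (inContext p′ q′ {u} {v} m) =
    subst₂ KnuthStep (reassoc p′ u q′) (reassoc p′ v q′) (inContext p′ (q′ ++ q) m)

≈ₖ-cong : ∀ p q {u v} → u ≈ₖ v → p ++ u ++ q ≈ₖ p ++ v ++ q
≈ₖ-cong p q = ≈ₖ-congˡ p ∘ ≈ₖ-congʳ q

≈ₖ-length : ∀ {u v} → u ≈ₖ v → length u ≡ length v
≈ₖ-length = EqClosure.gfold isEquivalence length step
  where
  step : ∀ {u v} → KnuthStep u v → length u ≡ length v
  step (inContext [] q (yxz↝yzx _ _)) = refl
  step (inContext [] q (xzy↝zxy _ _)) = refl
  step (inContext (_ ∷ p) q m) = cong suc (step (inContext p q m))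

readingWord-∷ : ∀ R P → readingWord (R ∷ P) ≡ readingWord P ++ R
readingWord-∷ R P = begin
  concat (reverse (R ∷ P))         ≡⟨ cong concat (unfold-reverse R P) ⟩
  concat (reverse P ++ R ∷ [])     ≡⟨ sym (concat-++ (reverse P) (R ∷ [])) ⟩
  concat (reverse P) ++ R ++ []    ≡⟨ cong (concat (reverse P) ++_) (++-identityʳ R) ⟩
  concat (reverse P) ++ R          ∎
  where open ≡-Reasoning

slideLeft : ∀ {x c} R → x <ℤ c → Sorted (c ∷ R) → c ∷ R ++ x ∷ [] ≈ₖ c ∷ x ∷ R
slideLeft [] _ _ = ≈ₖ-refl
slideLeft {x} {c} (s ∷ R) x<c (c≤s ∷ sorted) =
  ≈ₖ-trans (≈ₖ-congˡ (c ∷ []) (slideLeft R (<-≤-trans x<c c≤s) sorted))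
           (≈ₖ-sym (knuthAt [] R (yxz↝yzx x<c c≤s)))

bumpedFirst : ∀ {r} b L → Maybe.All (λ c → ColStrict L (c ∷ [])) b → r ≤Head L →
              r ∷ fromMaybe b ++ L ≈ₖ fromMaybe b ++ r ∷ L
bumpedFirst nothing L _ _ = ≈ₖ-refl
bumpedFirst (just c) (t ∷ L) (just (t<c , _)) (just r≤t) = knuthAt [] L (xzy↝zxy r≤t t<c)

row-≈ₖ-rowIns : ∀ x R → Sorted R → R ++ x ∷ [] ≈ₖ fromMaybe (bumped x R) ++ inserted x R
row-≈ₖ-rowIns x [] _ = ≈ₖ-refl
row-≈ₖ-rowIns x (r ∷ R) s with x <ℤ? r
... | yes x<r = slideLeft R x<r s
... | no x≮r =
  ≈ₖ-trans (≈ₖ-congˡ (r ∷ []) (row-≈ₖ-rowIns x R (Linked.tail s)))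
           (bumpedFirst (bumped x R) (inserted x R) (inserted-above-bumped x R)
                        (≤Head-inserted R (≮⇒≥ x≮r) (Linked.head′ s)))

readingWord-insert : ∀ x P → RowsSorted P → readingWord (insert x P) ≈ₖ readingWord P ++ x ∷ []
readingWord-insert x [] _ = ≈ₖ-refl
readingWord-insert x (R ∷ P) (s ∷ ss) = begin
  readingWord (insert x (R ∷ P))
    ≡⟨ cong readingWord (insert-∷ x R P) ⟩
  readingWord (inserted x R ∷ insertWord P b)
    ≡⟨ readingWord-∷ (inserted x R) (insertWord P b) ⟩
  readingWord (insertWord P b) ++ inserted x R
    ≈⟨ ≈ₖ-congʳ (inserted x R) (readingWord-insertBumped (bumped x R)) ⟩
  (readingWord P ++ b) ++ inserted x R
    ≡⟨ ++-assoc (readingWord P) b (inserted x R) ⟩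
  readingWord P ++ b ++ inserted x R
    ≈⟨ ≈ₖ-congˡ (readingWord P) (≈ₖ-sym (row-≈ₖ-rowIns x R s)) ⟩
  readingWord P ++ R ++ x ∷ []
    ≡⟨ sym (++-assoc (readingWord P) R (x ∷ [])) ⟩
  (readingWord P ++ R) ++ x ∷ []
    ≡⟨ cong (_++ x ∷ []) (sym (readingWord-∷ R P)) ⟩
  readingWord (R ∷ P) ++ x ∷ [] ∎
  where
  open ≈ₖ-Reasoning
  b = fromMaybe (bumped x R)
  readingWord-insertBumped : ∀ b? → readingWord (insertWord P (fromMaybe b?)) ≈ₖ readingWord P ++ fromMaybe b?
  readingWord-insertBumped nothing = ≈ₖ-reflexive (sym (++-identityʳ (readingWord P)))
  readingWord-insertBumped (just c) = readingWord-insert c P ss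

readingWord-insertWord : ∀ P w → RowsSorted P → readingWord (insertWord P w) ≈ₖ readingWord P ++ w
readingWord-insertWord P [] _ = ≈ₖ-reflexive (sym (++-identityʳ (readingWord P)))
readingWord-insertWord P (x ∷ w) s = begin
  readingWord (insertWord (insert x P) w) ≈⟨ readingWord-insertWord (insert x P) w (insert-rowsSorted x P s) ⟩
  readingWord (insert x P) ++ w           ≈⟨ ≈ₖ-congʳ w (readingWord-insert x P s) ⟩
  (readingWord P ++ x ∷ []) ++ w          ≡⟨ ++-assoc (readingWord P) (x ∷ []) w ⟩
  readingWord P ++ x ∷ w                  ∎
  where open ≈ₖ-Reasoning

-- Row insertion respects Knuth equivalence

sorted-head≤ : ∀ {r R} → Sorted (r ∷ R) → All (r ≤ℤ_) R
sorted-head≤ s with Linked⇒AllPairs ≤-trans s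
... | r≤R ∷ _ = r≤R

-- The one-row content of Fulton's Row Bumping Lemma, for two letters inserted in weakly
-- increasing order (here) and in strictly decreasing order (below).
rowBumping-≤ : ∀ {y z c} R → Sorted R → y ≤ℤ z → bumped z (inserted y R) ≡ just c →
               ∃[ d ] bumped y R ≡ just d × d ≤ℤ c
rowBumping-≤ [] _ y≤z eq with trans (sym (cong proj₁ (rowIns-≥ {R = []} y≤z refl))) eq
... | ()
rowBumping-≤ {y} {z} (h ∷ R) s y≤z eq with y <ℤ? h
... | yes _ =
  h , refl , atJust (bumped-All (sorted-head≤ s)) (trans (sym (cong proj₁ (rowIns-≥ y≤z refl))) eq)
... | no y≮h = rowBumping-≤ R (Linked.tail s) y≤z
                 (trans (sym (cong proj₁ (rowIns-≥ (≤-trans (≮⇒≥ y≮h) y≤z) refl))) eq)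

rowBumping-> : ∀ {r y z c} R → All (r ≤ℤ_) R → r ≤ℤ z → y <ℤ z → bumped z R ≡ just c →
               ∃[ d ] bumped y (inserted z R) ≡ just d × r ≤ℤ d × d ≤ℤ z
rowBumping-> [] _ _ _ ()
rowBumping-> {y = y} {z} (h ∷ R) (r≤h ∷ r≤R) r≤z y<z eq with z <ℤ? h
... | yes _ = z , cong proj₁ (rowIns-< {R = R} y<z) , r≤z , ≤-refl
... | no z≮h with y <ℤ? h
...   | yes _ = h , refl , r≤h , ≮⇒≥ z≮h
...   | no _ = rowBumping-> R r≤R r≤z y<z eq

yxz≈yzx-maybe : ∀ {x y} z? → x <ℤ y → Maybe.All (y ≤ℤ_) z? →
                y ∷ x ∷ fromMaybe z? ++ [] ≈ₖ y ∷ fromMaybe z? ++ x ∷ []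
yxz≈yzx-maybe nothing _ _ = ≈ₖ-refl
yxz≈yzx-maybe (just z) x<y (just y≤z) = knuth (yxz↝yzx x<y y≤z)

yxz≈yzx-maybe₂ : ∀ {x} y? z? → Maybe.All (x <ℤ_) y? →
                 (∀ {c} → z? ≡ just c → ∃[ d ] y? ≡ just d × d ≤ℤ c) →
                 fromMaybe y? ++ x ∷ fromMaybe z? ++ [] ≈ₖ fromMaybe y? ++ fromMaybe z? ++ x ∷ []
yxz≈yzx-maybe₂ y? nothing _ _ = ≈ₖ-refl
yxz≈yzx-maybe₂ y? (just c) x<y? z⇒y with z⇒y refl
... | d , refl , d≤c with x<y?
...   | just x<d = knuth (yxz↝yzx x<d d≤c)

xzy≈zxy-maybe : ∀ {x} z? y? →
                (∀ {c} → z? ≡ just c → ∃[ d ] y? ≡ just d × x ≤ℤ d × d <ℤ c) →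
                x ∷ fromMaybe z? ++ fromMaybe y? ++ [] ≈ₖ fromMaybe z? ++ x ∷ fromMaybe y? ++ []
xzy≈zxy-maybe nothing _ _ = ≈ₖ-refl
xzy≈zxy-maybe (just c) y? z⇒y with z⇒y refl
... | d , refl , x≤d , d<c = knuth (xzy↝zxy x≤d d<c)

record RowInsEquiv (R u v : List ℤ) : Set where
  constructor _,_
  field
    bumpedWords   : bumpedWord R u ≈ₖ bumpedWord R v
    insertedWords : insertedWord R u ≡ insertedWord R v

RowInsEquiv-isEquivalence : ∀ R → IsEquivalence (RowInsEquiv R)
RowInsEquiv-isEquivalence R = record
  { refl  = ≈ₖ-refl , refl
  ; sym   = λ (k , e) → ≈ₖ-sym k , sym e
  ; trans = λ (k , e) (k′ , e′) → ≈ₖ-trans k k′ , trans e e′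
  }

rowInsEquiv-by : ∀ {R u v bu bv Su Sv} → rowInsWord R u ≡ (bu , Su) → rowInsWord R v ≡ (bv , Sv) →
                 bu ≈ₖ bv → Su ≡ Sv → RowInsEquiv R u v
rowInsEquiv-by eu ev k s =
  subst₂ _≈ₖ_ (sym (cong proj₁ eu)) (sym (cong proj₁ ev)) k ,
  trans (cong proj₂ eu) (trans s (sym (cong proj₂ ev)))

rowInsWord-3 : ∀ a b c R {b₁ R₁ b₂ R₂ b₃ R₃} →
               rowIns a R ≡ (b₁ , R₁) → rowIns b R₁ ≡ (b₂ , R₂) → rowIns c R₂ ≡ (b₃ , R₃) →
               rowInsWord R (a ∷ b ∷ c ∷ []) ≡ (fromMaybe b₁ ++ fromMaybe b₂ ++ fromMaybe b₃ ++ [] , R₃)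
rowInsWord-3 a b c R {b₁} {R₁} {b₂} {R₂} e₁ e₂ e₃ =
  trans (rowInsWord-∷ {a} {R} (b ∷ c ∷ []) e₁) (cong (map₁ (fromMaybe b₁ ++_))
    (trans (rowInsWord-∷ {b} {R₁} (c ∷ []) e₂) (cong (map₁ (fromMaybe b₂ ++_))
      (rowInsWord-∷ {c} {R₂} [] e₃))))

rowInsEquiv-3 : ∀ {R a b c a′ b′ c′ b₁ R₁ b₂ R₂ b₃ S b₁′ R₁′ b₂′ R₂′ b₃′} →
  rowIns a R ≡ (b₁ , R₁) → rowIns b R₁ ≡ (b₂ , R₂) → rowIns c R₂ ≡ (b₃ , S) →
  rowIns a′ R ≡ (b₁′ , R₁′) → rowIns b′ R₁′ ≡ (b₂′ , R₂′) → rowIns c′ R₂′ ≡ (b₃′ , S) →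
  fromMaybe b₁ ++ fromMaybe b₂ ++ fromMaybe b₃ ++ [] ≈ₖ
    fromMaybe b₁′ ++ fromMaybe b₂′ ++ fromMaybe b₃′ ++ [] →
  RowInsEquiv R (a ∷ b ∷ c ∷ []) (a′ ∷ b′ ∷ c′ ∷ [])
rowInsEquiv-3 {R} {a} {b} {c} {a′} {b′} {c′} e₁ e₂ e₃ e₁′ e₂′ e₃′ k =
  rowInsEquiv-by (rowInsWord-3 a b c R e₁ e₂ e₃) (rowInsWord-3 a′ b′ c′ R e₁′ e₂′ e₃′) k refl

rowInsWord-≥ : ∀ {r} R w → All (r ≤ℤ_) w → rowInsWord (r ∷ R) w ≡ map₂ (r ∷_) (rowInsWord R w)
rowInsWord-≥ R [] _ = refl
rowInsWord-≥ R (a ∷ w) (r≤a ∷ r≤w) =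
  trans (rowInsWord-∷ w (rowIns-≥ r≤a refl))
        (cong (map₁ (fromMaybe (bumped a R) ++_)) (rowInsWord-≥ (inserted a R) w r≤w))

RowInsEquiv-≥ : ∀ {r} R {u v} → All (r ≤ℤ_) u → All (r ≤ℤ_) v →
                RowInsEquiv R u v → RowInsEquiv (r ∷ R) u v
RowInsEquiv-≥ {r} R {u} {v} r≤u r≤v (k , e) =
  rowInsEquiv-by (rowInsWord-≥ R u r≤u) (rowInsWord-≥ R v r≤v) k (cong (r ∷_) e)

rowIns-yxz≈yzx : ∀ {x y z} R → Sorted R → x <ℤ y → y ≤ℤ z →
                 RowInsEquiv R (y ∷ x ∷ z ∷ []) (y ∷ z ∷ x ∷ [])
rowIns-yxz≈yzx [] _ x<y y≤z =
  rowInsEquiv-3 refl (rowIns-< x<y) (rowIns-≥ (<⇒≤ (<-≤-trans x<y y≤z)) refl)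
                refl (rowIns-≥ y≤z refl) (rowIns-< x<y) ≈ₖ-refl
rowIns-yxz≈yzx {x} {y} {z} (r ∷ R) s x<y y≤z with x <or≥ r
... | inj₂ r≤x = RowInsEquiv-≥ R (r≤y ∷ r≤x ∷ r≤z ∷ []) (r≤y ∷ r≤z ∷ r≤x ∷ [])
                                 (rowIns-yxz≈yzx R (Linked.tail s) x<y y≤z)
  where
  r≤y = ≤-trans r≤x (<⇒≤ x<y)
  r≤z = ≤-trans r≤y y≤z
... | inj₁ x<r with y <or≥ r
...   | inj₁ y<r =
  rowInsEquiv-3 (rowIns-< y<r) (rowIns-< x<y) (rowIns-≥ (<⇒≤ (<-≤-trans x<y y≤z)) refl)
                (rowIns-< y<r) (rowIns-≥ y≤z refl) (rowIns-< x<y)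
                (yxz≈yzx-maybe (bumped z R) y<r (bumped-All (sorted-head≤ s)))
...   | inj₂ r≤y =
  rowInsEquiv-3 (rowIns-≥ r≤y refl) (rowIns-< x<r) (rowIns-≥ (<⇒≤ (<-≤-trans x<y y≤z)) refl)
                (rowIns-≥ r≤y refl) (rowIns-≥ (≤-trans r≤y y≤z) refl) (rowIns-< x<r)
                (yxz≈yzx-maybe₂ (bumped y R) (bumped z (inserted y R))
                   (Maybe.map (≤-<-trans r≤y) (bumped-> y R))
                   (rowBumping-≤ R (Linked.tail s) y≤z))

rowIns-xzy≈zxy : ∀ {x y z} R → Sorted R → x ≤ℤ y → y <ℤ z →
                 RowInsEquiv R (x ∷ z ∷ y ∷ []) (z ∷ x ∷ y ∷ [])
rowIns-xzy≈zxy [] _ x≤y y<z =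
  rowInsEquiv-3 refl (rowIns-≥ (<⇒≤ (≤-<-trans x≤y y<z)) refl) (rowIns-≥ x≤y (rowIns-< y<z))
                refl (rowIns-< (≤-<-trans x≤y y<z)) (rowIns-≥ x≤y refl) ≈ₖ-refl
rowIns-xzy≈zxy {x} {y} {z} (r ∷ R) s x≤y y<z with x <or≥ r
... | inj₂ r≤x = RowInsEquiv-≥ R (r≤x ∷ r≤z ∷ r≤y ∷ []) (r≤z ∷ r≤x ∷ r≤y ∷ [])
                                 (rowIns-xzy≈zxy R (Linked.tail s) x≤y y<z)
  where
  r≤y = ≤-trans r≤x x≤y
  r≤z = ≤-trans r≤y (<⇒≤ y<z)
... | inj₁ x<r with z <or≥ r
...   | inj₂ r≤z =
  rowInsEquiv-3 (rowIns-< x<r) (rowIns-≥ (<⇒≤ (≤-<-trans x≤y y<z)) refl) (rowIns-≥ x≤y refl)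
                (rowIns-≥ r≤z refl) (rowIns-< x<r) (rowIns-≥ x≤y refl)
                (xzy≈zxy-maybe (bumped z R) (bumped y (inserted z R)) bumps)
  where
  bumps : ∀ {c} → bumped z R ≡ just c → ∃[ d ] bumped y (inserted z R) ≡ just d × r ≤ℤ d × d <ℤ c
  bumps eq with rowBumping-> R (sorted-head≤ s) r≤z y<z eq
  ... | d , eq′ , r≤d , d≤z = d , eq′ , r≤d , ≤-<-trans d≤z (atJust (bumped-> z R) eq)
rowIns-xzy≈zxy (r ∷ []) _ x≤y y<z | inj₁ x<r | inj₁ z<r =
  rowInsEquiv-3 (rowIns-< x<r) (rowIns-≥ (<⇒≤ (≤-<-trans x≤y y<z)) refl) (rowIns-≥ x≤y (rowIns-< y<z))
                (rowIns-< z<r) (rowIns-< (≤-<-trans x≤y y<z)) (rowIns-≥ x≤y refl) ≈ₖ-refl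
rowIns-xzy≈zxy (r ∷ h ∷ R) (r≤h ∷ _) x≤y y<z | inj₁ x<r | inj₁ z<r =
  rowInsEquiv-3 (rowIns-< x<r) (rowIns-≥ (<⇒≤ x<z) (rowIns-< z<h)) (rowIns-≥ x≤y (rowIns-< y<z))
                (rowIns-< z<r) (rowIns-< x<z) (rowIns-≥ x≤y (rowIns-< (<-trans y<z z<h)))
                (≈ₖ-sym (knuth (yxz↝yzx z<r r≤h)))
  where
  x<z = ≤-<-trans x≤y y<z
  z<h = <-≤-trans z<r r≤h

rowIns-move : ∀ R {u v} → Sorted R → KnuthMove u v → RowInsEquiv R u v
rowIns-move R s (yxz↝yzx x<y y≤z) = rowIns-yxz≈yzx R s x<y y≤z
rowIns-move R s (xzy↝zxy x≤y y<z) = rowIns-xzy≈zxy R s x≤y y<z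

rowInsWord-++₃ : ∀ R p u q → rowInsWord R (p ++ u ++ q) ≡
  ( bumpedWord R p ++ bumpedWord (insertedWord R p) u ++ bumpedWord (insertedWord (insertedWord R p) u) q
  , insertedWord (insertedWord (insertedWord R p) u) q )
rowInsWord-++₃ R p u q =
  trans (rowInsWord-++ R p (u ++ q)) (cong (map₁ (bumpedWord R p ++_)) (rowInsWord-++ (insertedWord R p) u q))

RowInsEquiv-inContext : ∀ R p q {u v} → RowInsEquiv (insertedWord R p) u v →
                        RowInsEquiv R (p ++ u ++ q) (p ++ v ++ q)
RowInsEquiv-inContext R p q {u} {v} (k , e) =
  rowInsEquiv-by (rowInsWord-++₃ R p u q) (rowInsWord-++₃ R p v q)
    (subst (λ S → _ ≈ₖ bumpedWord R p ++ bumpedWord (insertedWord R p) v ++ bumpedWord S q) e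
           (≈ₖ-cong (bumpedWord R p) _ k))
    (cong (λ S → insertedWord S q) e)

rowInsWord-≈ₖ : ∀ R {u v} → Sorted R → u ≈ₖ v → RowInsEquiv R u v
rowInsWord-≈ₖ R s = EqClosure.fold (RowInsEquiv-isEquivalence R) step
  where
  step : ∀ {u v} → KnuthStep u v → RowInsEquiv R u v
  step (inContext p q m) = RowInsEquiv-inContext R p q (rowIns-move _ (insertedWord-sorted R p s) m)

bumpedWord-length : ∀ R w → length (bumpedWord R w) ≤ length w
bumpedWord-length R [] = z≤n
bumpedWord-length R (a ∷ w) =
  ℕ.≤-trans (fromMaybe-++-length (bumped a R) _) (s≤s (bumpedWord-length (inserted a R) w))
  where
  fromMaybe-++-length : ∀ (b? : Maybe ℤ) v → length (fromMaybe b? ++ v) ≤ suc (length v)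
  fromMaybe-++-length nothing v = ℕ.n≤1+n _
  fromMaybe-++-length (just _) v = ℕ.≤-refl

-- insertWord [] (a ∷ u) is insertWord ([] ∷ []) (a ∷ u), so the empty tableau behaves like one
-- empty row; the recursion is on the length of the word.
insertWord-[]-≈ₖ : ∀ k {u v} → length u ≤ k → u ≈ₖ v → insertWord [] u ≡ insertWord [] v
insertWord-[]-≈ₖ k {[]} {[]} _ _ = refl
insertWord-[]-≈ₖ k {[]} {_ ∷ _} _ u≈v with ≈ₖ-length u≈v
... | ()
insertWord-[]-≈ₖ k {_ ∷ _} {[]} _ u≈v with ≈ₖ-length u≈v
... | ()
insertWord-[]-≈ₖ (suc k) {a ∷ u} {b ∷ v} (s≤s |u|≤k) u≈v with rowInsWord-≈ₖ [] [] u≈v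
... | bumps≈ , rows≡ = begin
  insertWord ([] ∷ []) (a ∷ u)
    ≡⟨ insertWord-∷ [] [] (a ∷ u) ⟩
  insertedWord [] (a ∷ u) ∷ insertWord [] (bumpedWord [] (a ∷ u))
    ≡⟨ cong₂ _∷_ rows≡ (insertWord-[]-≈ₖ k shorter bumps≈) ⟩
  insertedWord [] (b ∷ v) ∷ insertWord [] (bumpedWord [] (b ∷ v))
    ≡⟨ insertWord-∷ [] [] (b ∷ v) ⟨
  insertWord ([] ∷ []) (b ∷ v) ∎
  where
  open ≡-Reasoning
  shorter = ℕ.≤-trans (bumpedWord-length (a ∷ []) u) |u|≤k

insertWord-≈ₖ : ∀ P {u v} → RowsSorted P → u ≈ₖ v → insertWord P u ≡ insertWord P v
insertWord-≈ₖ [] {u} _ = insertWord-[]-≈ₖ (length u) ℕ.≤-refl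
insertWord-≈ₖ (R ∷ P) {u} {v} (s ∷ ss) u≈v with rowInsWord-≈ₖ R s u≈v
... | bumps≈ , rows≡ = begin
  insertWord (R ∷ P) u                              ≡⟨ insertWord-∷ R P u ⟩
  insertedWord R u ∷ insertWord P (bumpedWord R u)  ≡⟨ cong₂ _∷_ rows≡ (insertWord-≈ₖ P ss bumps≈) ⟩
  insertedWord R v ∷ insertWord P (bumpedWord R v)  ≡⟨ insertWord-∷ R P v ⟨
  insertWord (R ∷ P) v                              ∎
  where open ≡-Reasoning

·-assoc : ∀ A B C → RowsSorted A → RowsSorted B → A · (B · C) ≡ (A · B) · C
·-assoc A B C sA sB = begin
  insertWord A (readingWord (B · C))
    ≡⟨ insertWord-≈ₖ A sA (readingWord-insertWord B (readingWord C) sB) ⟩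
  insertWord A (readingWord B ++ readingWord C)
    ≡⟨ foldl-++ _ A (readingWord B) (readingWord C) ⟩
  insertWord (insertWord A (readingWord B)) (readingWord C) ∎
  where open ≡-Reasoning

-- Two cuts xs ++ ys = xs′ ++ ys′ of a path, made together with cuts of its labels at the same
-- positions.
data Split {X Y : Set} (xs ys xs′ ys′ : List X) (ls rs ls′ rs′ : List Y) : Set where
  same    : xs ≡ xs′ → ys ≡ ys′ → ls ≡ ls′ → rs ≡ rs′ → Split xs ys xs′ ys′ ls rs ls′ rs′
  shorter : ∀ a m l lm → length lm ≡ length m → xs′ ≡ xs ++ a ∷ m → ys ≡ a ∷ m ++ ys′ →
            ls′ ≡ ls ++ l ∷ lm → rs ≡ l ∷ lm ++ rs′ → Split xs ys xs′ ys′ ls rs ls′ rs′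
  longer  : ∀ a m l lm → length lm ≡ length m → xs ≡ xs′ ++ a ∷ m → ys′ ≡ a ∷ m ++ ys →
            ls ≡ ls′ ++ l ∷ lm → rs′ ≡ l ∷ lm ++ rs → Split xs ys xs′ ys′ ls rs ls′ rs′

split : ∀ {X Y : Set} (xs xs′ : List X) (ls ls′ : List Y) {ys ys′ rs rs′} →
        xs ++ ys ≡ xs′ ++ ys′ → ls ++ rs ≡ ls′ ++ rs′ →
        length ls ≡ length xs → length ls′ ≡ length xs′ →
        Split xs ys xs′ ys′ ls rs ls′ rs′
split [] [] [] [] e f _ _ = same refl e refl f
split [] (a ∷ xs′) [] (l ∷ ls′) e f _ len′ = shorter a xs′ l ls′ (ℕ.suc-injective len′) refl e refl f
split (a ∷ xs) [] (l ∷ ls) [] e f len _ = longer a xs l ls (ℕ.suc-injective len) refl (sym e) refl (sym f)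
split (x ∷ xs) (x′ ∷ xs′) (l ∷ ls) (l′ ∷ ls′) e f len len′ with ∷-injective e | ∷-injective f
... | refl , e′ | refl , f′
  with split xs xs′ ls ls′ e′ f′ (ℕ.suc-injective len) (ℕ.suc-injective len′)
...   | same p q r t = same (cong (x ∷_) p) q (cong (l ∷_) r) t
...   | shorter a m k lm |lm| p q r t = shorter a m k lm |lm| (cong (x ∷_) p) q (cong (l ∷_) r) t
...   | longer a m k lm |lm| p q r t = longer a m k lm |lm| (cong (x ∷_) p) q (cong (l ∷_) r) t

length-++-cong : ∀ {X Y : Set} (xs : List X) (ys : List Y) {xs′ ys′} →
                 length xs ≡ length ys → length xs′ ≡ length ys′ →
                 length (xs ++ xs′) ≡ length (ys ++ ys′)
length-++-cong xs ys p q = trans (length-++ xs) (trans (cong₂ _+_ p q) (sym (length-++ ys)))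

-- Factor sequences

isTableau⇒rowsSorted : ∀ {P} → IsTableau P → RowsSorted P
isTableau⇒rowsSorted = proj₁ ∘ proj₂

insertWord-≡-[] : ∀ P w → insertWord P w ≡ [] → P ≡ [] × w ≡ []
insertWord-≡-[] [] [] _ = refl , refl
insertWord-≡-[] [] (x ∷ w) eq with trans (sym (insertWord-∷ (x ∷ []) [] w)) eq
... | ()
insertWord-≡-[] (R ∷ P) w eq with trans (sym (insertWord-∷ R P w)) eq
... | ()

readingWord-≡-[] : ∀ C → All (_≢ []) C → readingWord C ≡ [] → C ≡ []
readingWord-≡-[] [] _ _ = refl
readingWord-≡-[] (R ∷ C) (R≢[] ∷ _) eq =
  contradiction (++-conicalʳ (readingWord C) R (trans (sym (readingWord-∷ R C)) eq)) R≢[]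

·-≡-[] : ∀ B C → IsTableau C → B · C ≡ [] → B ≡ [] × C ≡ []
·-≡-[] B C (nonempty , _) eq with insertWord-≡-[] B (readingWord C) eq
... | B≡[] , w≡[] = B≡[] , readingWord-≡-[] C nonempty w≡[]

module _ {n : ℕ} {T : ℕ → ℕ → Tableau} where

  tableauAt : List Step → Tableau
  tableauAt pre = T (fst (walk (0 , 0) pre)) (suc (snd (walk (0 , 0) pre)))

  labels-rowsSorted : ∀ {γ L} → FactorSeq n T γ L → All RowsSorted L
  labels-rowsSorted lowestFS = All.replicate⁺ (n + n) []
  labels-rowsSorted (case1 _ _ ls _ _ _ _ _ _ fs tP tQ _) =
    All.++⁺ (All.++⁻ˡ ls sorted)
            (isTableau⇒rowsSorted tP ∷ isTableau⇒rowsSorted tQ ∷ All.tail (All.++⁻ʳ ls sorted))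
    where sorted = labels-rowsSorted fs
  labels-rowsSorted (case2 pre _ ls _ Q P _ _ fs) with All.++⁻ʳ ls (labels-rowsSorted fs)
  ... | sQ ∷ _ ∷ sRest =
    All.++⁺ (All.++⁻ˡ ls (labels-rowsSorted fs))
            (·-rowsSorted _ P (·-rowsSorted Q (tableauAt pre) sQ) ∷ sRest)

  Rebracketable : List Step → List Tableau → Set
  Rebracketable γ L =
    ∀ pre s post ls rs A B C → γ ≡ pre ++ s ∷ D ∷ post → L ≡ ls ++ A ∷ B · C ∷ rs →
    length ls ≡ length pre → IsTableau B → IsTableau C → FactorSeq n T γ (ls ++ A · B ∷ C ∷ rs)

  rebracket-lowest : Rebracketable (lowest n) (replicate (n + n) [])
  rebracket-lowest _ _ _ ls _ _ B C _ L≡ _ _ tC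
    with All.++⁻ʳ ls (subst (All (_≡ [])) L≡ (All.replicate⁺ (n + n) refl))
  ... | _ ∷ B·C≡[] ∷ _ with ·-≡-[] B C tC B·C≡[]
  ...   | refl , refl = subst (FactorSeq n T (lowest n)) L≡ lowestFS

  rebracket-case1 : ∀ pre₁ post₁ ls₁ rs₁ W P Q →
                    IsPath n (pre₁ ++ U ∷ D ∷ post₁) → length ls₁ ≡ length pre₁ →
                    FactorSeq n T (pre₁ ++ H ∷ post₁) (ls₁ ++ W ∷ rs₁) →
                    Rebracketable (pre₁ ++ H ∷ post₁) (ls₁ ++ W ∷ rs₁) →
                    IsTableau P → IsTableau Q → W ≡ P · Q →
                    Rebracketable (pre₁ ++ U ∷ D ∷ post₁) (ls₁ ++ P ∷ Q ∷ rs₁)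
  rebracket-case1 pre₁ post₁ ls₁ rs₁ W P Q path |ls₁| fs ih tP tQ W≡P·Q
                  pre s post ls rs A B C γ≡ L≡ |ls| tB tC
    with split pre pre₁ ls ls₁ (sym γ≡) (sym L≡) |ls| |ls₁|
  -- no case for the pair ending on the U of U ∷ D: its second step is D
  ... | same refl refl refl refl =
    case1 pre post ls rs W (A · B) C path |ls₁| fs (·-isTableau A B tP) tC
      (trans W≡P·Q (·-assoc A B C (isTableau⇒rowsSorted tP) (isTableau⇒rowsSorted tB)))
  ... | shorter _ (_ ∷ m) _ (_ ∷ mL) |mL| refl refl refl refl =
    subst (FactorSeq n T _) (++-assoc ls (A · B ∷ C ∷ mL) _)
      (case1 (pre ++ s ∷ D ∷ m) post₁ (ls ++ A · B ∷ C ∷ mL) rs₁ W P Q path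
        (length-++-cong ls pre |ls| (cong suc |mL|))
        (subst (FactorSeq n T _) (sym (++-assoc ls (A · B ∷ C ∷ mL) _))
          (ih pre s (m ++ H ∷ post₁) ls (mL ++ W ∷ rs₁) A B C
              (++-assoc pre (s ∷ D ∷ m) _) (++-assoc ls (A ∷ B · C ∷ mL) _) |ls| tB tC))
        tP tQ W≡P·Q)
  ... | longer _ [] _ [] _ refl refl refl refl =
    subst (FactorSeq n T _) (sym (++-assoc ls₁ (P ∷ []) _))
      (case1 pre₁ (D ∷ post) ls₁ (C ∷ rs) (W · B) P (A · B) path |ls₁|
        (ih pre₁ H post ls₁ rs W B C refl refl |ls₁| tB tC) tP (·-isTableau A B tQ)
        (trans (cong (_· B) W≡P·Q)
               (sym (·-assoc P A B (isTableau⇒rowsSorted tP) (isTableau⇒rowsSorted tQ)))))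
  ... | longer _ (_ ∷ m) _ (_ ∷ mL) |mL| refl refl refl refl =
    subst (FactorSeq n T _) (sym (++-assoc ls₁ (P ∷ Q ∷ mL) _))
      (case1 pre₁ (m ++ s ∷ D ∷ post) ls₁ (mL ++ A · B ∷ C ∷ rs) W P Q path |ls₁|
        (subst (FactorSeq n T _) (++-assoc ls₁ (W ∷ mL) _)
          (ih (pre₁ ++ H ∷ m) s post (ls₁ ++ W ∷ mL) rs A B C
              (sym (++-assoc pre₁ (H ∷ m) _)) (sym (++-assoc ls₁ (W ∷ mL) _))
              (length-++-cong ls₁ pre₁ |ls₁| |mL|) tB tC))
        tP tQ W≡P·Q)

  rebracket-case2 : ∀ pre₂ post₂ ls₂ rs₂ Q P →
                    IsPath n (pre₂ ++ H ∷ post₂) → length ls₂ ≡ length pre₂ →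
                    FactorSeq n T (pre₂ ++ D ∷ U ∷ post₂) (ls₂ ++ Q ∷ P ∷ rs₂) →
                    Rebracketable (pre₂ ++ D ∷ U ∷ post₂) (ls₂ ++ Q ∷ P ∷ rs₂) →
                    Rebracketable (pre₂ ++ H ∷ post₂) (ls₂ ++ Q · tableauAt pre₂ · P ∷ rs₂)
  rebracket-case2 pre₂ post₂ ls₂ rs₂ Q P path |ls₂| fs ih pre s post ls rs A B C γ≡ L≡ |ls| tB tC
    with split pre pre₂ ls ls₂ (sym γ≡) (sym L≡) |ls| |ls₂|
  -- no case for the pair ending on the H: its second step is D
  ... | same refl refl refl refl =
    subst (λ X → FactorSeq n T _ (ls ++ X ∷ C ∷ rs))
          (·-assoc (Q · tableauAt pre) P B (·-rowsSorted Q (tableauAt pre) (All.head sorted))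
                   (All.head (All.tail sorted)))
      (case2 pre (D ∷ post) ls (C ∷ rs) Q (P · B) path |ls₂|
        (subst (FactorSeq n T _) (++-assoc ls (Q ∷ []) _)
          (ih (pre ++ D ∷ []) U post (ls ++ Q ∷ []) rs P B C
              (sym (++-assoc pre (D ∷ []) _)) (sym (++-assoc ls (Q ∷ []) _))
              (length-++-cong ls pre |ls| refl) tB tC)))
    where sorted = All.++⁻ʳ ls (labels-rowsSorted fs)
  ... | shorter _ (_ ∷ m) _ (_ ∷ mL) |mL| refl refl refl refl =
    subst (FactorSeq n T _) (++-assoc ls (A · B ∷ C ∷ mL) _)
      (case2 (pre ++ s ∷ D ∷ m) post₂ (ls ++ A · B ∷ C ∷ mL) rs₂ Q P path
        (length-++-cong ls pre |ls| (cong suc |mL|))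
        (subst (FactorSeq n T _) (sym (++-assoc ls (A · B ∷ C ∷ mL) _))
          (ih pre s (m ++ D ∷ U ∷ post₂) ls (mL ++ Q ∷ P ∷ rs₂) A B C
              (++-assoc pre (s ∷ D ∷ m) _) (++-assoc ls (A ∷ B · C ∷ mL) _) |ls| tB tC)))
  ... | longer _ m _ mL |mL| refl refl refl refl =
    subst (FactorSeq n T _) (sym (++-assoc ls₂ (_ ∷ mL) _))
      (case2 pre₂ (m ++ s ∷ D ∷ post) ls₂ (mL ++ A · B ∷ C ∷ rs) Q P path |ls₂|
        (subst (FactorSeq n T _) (++-assoc ls₂ (Q ∷ P ∷ mL) _)
          (ih (pre₂ ++ D ∷ U ∷ m) s post (ls₂ ++ Q ∷ P ∷ mL) rs A B C
              (sym (++-assoc pre₂ (D ∷ U ∷ m) _)) (sym (++-assoc ls₂ (Q ∷ P ∷ mL) _))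
              (length-++-cong ls₂ pre₂ |ls₂| (cong (suc ∘ suc) |mL|)) tB tC)))

  rebracket : ∀ {γ L} → FactorSeq n T γ L → Rebracketable γ L
  rebracket lowestFS = rebracket-lowest
  rebracket (case1 pre post ls rs W P Q path |ls| fs tP tQ W≡P·Q) =
    rebracket-case1 pre post ls rs W P Q path |ls| fs (rebracket fs) tP tQ W≡P·Q
  rebracket (case2 pre post ls rs Q P path |ls| fs) =
    rebracket-case2 pre post ls rs Q P path |ls| fs (rebracket fs)

lemma6 : (n : ℕ) (r : ℕ → ℕ → ℕ) → RankConditions n r →
         (T : ℕ → ℕ → Tableau) → TableauDiagram n r T →
         (γ : List Step) → IsPath n γ →
         (pre : List Step) (s : Step) (post : List Step) →
         γ ≡ pre ++ s ∷ D ∷ post →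
         (ls rs : List Tableau) (A B C : Tableau) →
         length ls ≡ length pre →
         IsTableau B → IsTableau C →
         FactorSeq n T γ (ls ++ A ∷ (B · C) ∷ rs) →
         FactorSeq n T γ (ls ++ (A · B) ∷ C ∷ rs)
lemma6 _ _ _ _ _ _ _ pre s post γ≡ ls rs A B C |ls| tB tC fs =
  rebracket fs pre s post ls rs A B C γ≡ refl |ls| tB tC
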